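{- There is a bijection $f$ from the set of strictly alternating bargraphs other than $UHD$ to the set $\mathcal K$ such that for every such bargraph $G$, $\#U(f(G))+\#D(f(G))+1=\#H(G)$ and $\#H(f(G))+2=\#U(G)$. In particular $f$ maps strictly alternating bargraphs of semiperimeter $n$ (for $n\ge3$) onto paths in $\mathcal K$ with $n-3$ steps.
   Context: A bargraph is a lattice path with steps $U=(0,1)$, $H=(1,0)$, $D=(0,-1)$, identified with its word over $\{U,H,D\}$, that starts at the origin, ends on the $x$-axis, stays strictly above the $x$-axis except at its endpoints, and contains no two consecutive steps $UD$ or $DU$. Its semiperimeter is its number of $U$ steps plus its number of $H$ steps. A bargraph is strictly alternating if it has the form $U^{i_1}HD^{k_1}HU^{i_2}HD^{k_2}H\cdots U^{i_m}HD^{k_m}$ for some $m\ge1$ and positive integers $i_r,k_r$. $\mathcal K$ is the set of Motzkin paths (lattice paths with steps $U=(1,1)$, $H=(1,0)$, $D=(1,-1)$ from the origin to the $x$-axis never going below it, including the empty path) containing no consecutive pair of steps $UD$, $UU$ or $DD$. $\#U,\#H,\#D$ denote numbers of steps of each kind. -}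

module Defs where

open import Data.Nat using (ℕ; zero; suc; _+_; _≤_; _<_)
open import Data.Integer as ℤ using (ℤ; +_; -[1+_])
open import Data.List using (List; []; _∷_; _++_; replicate; length)
open import Data.List.NonEmpty using (List⁺; _∷_)
open import Data.Product using (_×_; _,_; ∃; ∃-syntax; Σ)
open import Relation.Binary.PropositionalEquality using (_≡_; _≢_)
open import Relation.Nullary using (¬_)

-- Steps.  For bargraphs: U=(0,1), H=(1,0), D=(0,-1).
-- For Motzkin paths:     U=(1,1), H=(1,0), D=(1,-1).
-- In both cases a path is identified with its word.
data Step : Set where
  U H D : Step

δ : Step → ℤ
δ U = + 1
δ H = + 0
δ D = -[1+ 0 ]

height : List Step → ℤ
height []       = + 0
height (s ∷ w)  = δ s ℤ.+ height w

count : Step → List Step → ℕ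
count s [] = 0
count U (U ∷ w) = suc (count U w)
count H (H ∷ w) = suc (count H w)
count D (D ∷ w) = suc (count D w)
count U (H ∷ w) = count U w
count U (D ∷ w) = count U w
count H (U ∷ w) = count H w
count H (D ∷ w) = count H w
count D (U ∷ w) = count D w
count D (H ∷ w) = count D w

#U #H #D : List Step → ℕ
#U = count U
#H = count H
#D = count D

HasFactor : Step → Step → List Step → Set
HasFactor a b w = ∃[ p ] ∃[ s ] (w ≡ p ++ a ∷ b ∷ s)

record Bargraph (w : List Step) : Set where
  field
    nonempty  : w ≢ []
    endsOnAxis : height w ≡ + 0
    strictlyAbove : ∀ p s → w ≡ p ++ s → p ≢ [] → s ≢ [] → + 0 ℤ.< height p
    noUD : ¬ HasFactor U D w
    noDU : ¬ HasFactor D U w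

semiperimeter : List Step → ℕ
semiperimeter w = #U w + #H w

block : ℕ × ℕ → List Step
block (i , k) = replicate i U ++ H ∷ replicate k D

saWord' : ℕ × ℕ → List (ℕ × ℕ) → List Step
saWord' b []        = block b
saWord' b (c ∷ cs)  = block b ++ H ∷ saWord' c cs

saWord : List⁺ (ℕ × ℕ) → List Step
saWord (b ∷ bs) = saWord' b bs

data AllPos : List (ℕ × ℕ) → Set where
  []  : AllPos []
  _∷_ : ∀ {i k bs} → (1 ≤ i × 1 ≤ k) → AllPos bs → AllPos ((i , k) ∷ bs)

StrictlyAlternating : List Step → Set
StrictlyAlternating w =
  ∃[ bs ] (AllPos (Data.List.NonEmpty.toList bs) × w ≡ saWord bs)

SAB : List Step → Set
SAB w = Bargraph w × StrictlyAlternating w × w ≢ U ∷ H ∷ D ∷ []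

record Motzkin (w : List Step) : Set where
  field
    endsOnAxis : height w ≡ + 0
    nonneg : ∀ p s → w ≡ p ++ s → + 0 ℤ.≤ height p

InK : List Step → Set
InK w = Motzkin w × ¬ HasFactor U D w × ¬ HasFactor U U w × ¬ HasFactor D D w

-- Write G = U^i₁ H D^k₁ H ⋯ U^iₘ H D^kₘ and mark, in the sequence of its U steps and in the
-- sequence of its D steps, the steps that open a new run. Drop the first step of each sequence
-- and pair the rest position by position: this gives Σi − 1 = Σk − 1 tokens, each rendered as D
-- if its U step opens a run, followed by U if its D step opens a run, with H between tokens.
-- The image avoids UD, UU and DD and has m − 1 steps U, m − 1 steps D and Σi − 2 steps H.
-- While reading, the U sequence is ahead of the D sequence by the height of the current column
-- of G, and the run openings in this lag count the height of the image; so the columns of G stay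
-- positive exactly when the image stays weakly above the axis. Reading off the run lengths of the
-- two marked sequences inverts the construction.

module Submission where

open import Defs
open import Data.Bool using (Bool; true; false; _∧_; T)
open import Data.Empty using (⊥-elim)
open import Data.Integer as ℤ using (ℤ; +_; -[1+_]; +≤+; +<+)
import Data.Integer.Properties as ℤP
open import Data.List using (List; []; _∷_; _++_; replicate; length; zip; unzip; drop)
import Data.List.Properties as LP
open import Data.List.NonEmpty as List⁺ using (List⁺; _∷_; toList)
open import Data.List.Relation.Unary.All using (All; []; _∷_)
open import Data.List.Relation.Unary.Linked using (Linked; []; [-]; _∷_; tail)
open import Data.Nat using (ℕ; zero; suc; pred; _+_; _∸_; _⊓_; _≤_; _<_; _≡ᵇ_; _≤ᵇ_; z≤n; s≤s)
open import Data.Nat.ListAction using (sum)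
import Data.Nat.Properties as ℕP
open import Data.Nat.Tactic.RingSolver using (solve-∀)
open import Data.Product using (_×_; _,_; proj₁; proj₂; Σ)
open import Function using (id)
open import Relation.Binary.PropositionalEquality
open import Relation.Nullary using (¬_; ofʸ; ofⁿ)
open ≡-Reasoning

length≡#U+#H+#D : ∀ w → length w ≡ #U w + #H w + #D w
length≡#U+#H+#D [] = refl
length≡#U+#H+#D (U ∷ w) = cong suc (length≡#U+#H+#D w)
length≡#U+#H+#D (H ∷ w) =
  trans (cong suc (length≡#U+#H+#D w)) (cong (_+ #D w) (sym (ℕP.+-suc (#U w) (#H w))))
length≡#U+#H+#D (D ∷ w) =
  trans (cong suc (length≡#U+#H+#D w)) (sym (ℕP.+-suc (#U w + #H w) (#D w)))

heightFrom : ℕ → List Step → ℤ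
heightFrom n w = + n ℤ.+ height w

heightFrom-U : ∀ n w → heightFrom n (U ∷ w) ≡ heightFrom (suc n) w
heightFrom-U n w = trans (sym (ℤP.+-assoc (+ n) (+ 1) (height w))) (cong (λ m → heightFrom m w) (ℕP.+-comm n 1))

heightFrom-H : ∀ n w → heightFrom n (H ∷ w) ≡ heightFrom n w
heightFrom-H n w = cong (ℤ._+_ (+ n)) (ℤP.+-identityˡ (height w))

heightFrom-D : ∀ n w → heightFrom (suc n) (D ∷ w) ≡ heightFrom n w
heightFrom-D n w = sym (ℤP.+-assoc (+ suc n) -[1+ 0 ] (height w))

heightFrom0 : ∀ w → heightFrom 0 w ≡ height w
heightFrom0 w = ℤP.+-identityˡ (height w)

-- Motzkin paths as a counter automaton

motzkinFrom : ℕ → List Step → Bool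
motzkinFrom n [] = n ≡ᵇ 0
motzkinFrom n (U ∷ w) = motzkinFrom (suc n) w
motzkinFrom n (H ∷ w) = motzkinFrom n w
motzkinFrom zero (D ∷ w) = false
motzkinFrom (suc n) (D ∷ w) = motzkinFrom n w

NonNegFrom : ℕ → List Step → Set
NonNegFrom n w = ∀ p s → w ≡ p ++ s → + 0 ℤ.≤ heightFrom n p

nonNegFrom-∷ : ∀ {n m x w} → (∀ p → heightFrom n (x ∷ p) ≡ heightFrom m p) →
               NonNegFrom n (x ∷ w) → NonNegFrom m w
nonNegFrom-∷ {x = x} shift nn p s refl = subst (+ 0 ℤ.≤_) (shift p) (nn (x ∷ p) s refl)

motzkinFrom-complete : ∀ n w → NonNegFrom n w → heightFrom n w ≡ + 0 → motzkinFrom n w ≡ true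
motzkinFrom-complete zero [] nn end = refl
motzkinFrom-complete n (U ∷ w) nn end =
  motzkinFrom-complete (suc n) w (nonNegFrom-∷ (heightFrom-U n) nn) (trans (sym (heightFrom-U n w)) end)
motzkinFrom-complete n (H ∷ w) nn end =
  motzkinFrom-complete n w (nonNegFrom-∷ (heightFrom-H n) nn) (trans (sym (heightFrom-H n w)) end)
motzkinFrom-complete zero (D ∷ w) nn end with nn (D ∷ []) w refl
... | ()
motzkinFrom-complete (suc n) (D ∷ w) nn end =
  motzkinFrom-complete n w (nonNegFrom-∷ (heightFrom-D n) nn) (trans (sym (heightFrom-D n w)) end)

motzkinFrom-nonNeg : ∀ n w → motzkinFrom n w ≡ true → NonNegFrom n w
motzkinFrom-nonNeg n w acc [] s eq = +≤+ z≤n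
motzkinFrom-nonNeg n (U ∷ w) acc (U ∷ p) s refl =
  subst (+ 0 ℤ.≤_) (sym (heightFrom-U n p)) (motzkinFrom-nonNeg (suc n) w acc p s refl)
motzkinFrom-nonNeg n (H ∷ w) acc (H ∷ p) s refl =
  subst (+ 0 ℤ.≤_) (sym (heightFrom-H n p)) (motzkinFrom-nonNeg n w acc p s refl)
motzkinFrom-nonNeg (suc n) (D ∷ w) acc (D ∷ p) s refl =
  subst (+ 0 ℤ.≤_) (sym (heightFrom-D n p)) (motzkinFrom-nonNeg n w acc p s refl)

motzkinFrom-end : ∀ n w → motzkinFrom n w ≡ true → heightFrom n w ≡ + 0
motzkinFrom-end zero [] acc = refl
motzkinFrom-end n (U ∷ w) acc = trans (heightFrom-U n w) (motzkinFrom-end (suc n) w acc)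
motzkinFrom-end n (H ∷ w) acc = trans (heightFrom-H n w) (motzkinFrom-end n w acc)
motzkinFrom-end (suc n) (D ∷ w) acc = trans (heightFrom-D n w) (motzkinFrom-end n w acc)

motzkin⇒motzkinFrom0 : ∀ {w} → Motzkin w → motzkinFrom 0 w ≡ true
motzkin⇒motzkinFrom0 {w} m = motzkinFrom-complete 0 w
  (λ p s eq → subst (+ 0 ℤ.≤_) (sym (heightFrom0 p)) (Motzkin.nonneg m p s eq))
  (trans (heightFrom0 w) (Motzkin.endsOnAxis m))

motzkinFrom0⇒motzkin : ∀ {w} → motzkinFrom 0 w ≡ true → Motzkin w
motzkinFrom0⇒motzkin {w} acc = record
  { endsOnAxis = trans (sym (heightFrom0 w)) (motzkinFrom-end 0 w acc)
  ; nonneg = λ p s eq → subst (+ 0 ℤ.≤_) (heightFrom0 p) (motzkinFrom-nonNeg 0 w acc p s eq)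
  }

motzkinFrom-balance : ∀ n w → motzkinFrom n w ≡ true → n + #U w ≡ #D w
motzkinFrom-balance zero [] acc = refl
motzkinFrom-balance n (U ∷ w) acc = trans (ℕP.+-suc n (#U w)) (motzkinFrom-balance (suc n) w acc)
motzkinFrom-balance n (H ∷ w) acc = motzkinFrom-balance n w acc
motzkinFrom-balance (suc n) (D ∷ w) acc = cong suc (motzkinFrom-balance n w acc)

-- Bargraphs, after their first step U, as a counter automaton that must stay positive

bargraphFrom : ℕ → List Step → Bool
bargraphFrom n [] = n ≡ᵇ 0
bargraphFrom zero (_ ∷ _) = false
bargraphFrom (suc n) (U ∷ w) = bargraphFrom (suc (suc n)) w
bargraphFrom (suc n) (H ∷ w) = bargraphFrom (suc n) w
bargraphFrom (suc n) (D ∷ w) = bargraphFrom n w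

PositiveFrom : ℕ → List Step → Set
PositiveFrom n w = ∀ p s → w ≡ p ++ s → s ≢ [] → + 0 ℤ.< heightFrom n p

positiveFrom-∷ : ∀ {n m x w} → (∀ p → heightFrom n (x ∷ p) ≡ heightFrom m p) →
                 PositiveFrom n (x ∷ w) → PositiveFrom m w
positiveFrom-∷ {x = x} shift pos p s refl s≢[] = subst (+ 0 ℤ.<_) (shift p) (pos (x ∷ p) s refl s≢[])

bargraphFrom-complete : ∀ n w → PositiveFrom n w → heightFrom n w ≡ + 0 → bargraphFrom n w ≡ true
bargraphFrom-complete zero [] pos end = refl
bargraphFrom-complete zero (x ∷ w) pos end with pos [] (x ∷ w) refl (λ ())
... | +<+ ()
bargraphFrom-complete (suc n) (U ∷ w) pos end =
  bargraphFrom-complete (suc (suc n)) w (positiveFrom-∷ (heightFrom-U (suc n)) pos) (trans (sym (heightFrom-U (suc n) w)) end)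
bargraphFrom-complete (suc n) (H ∷ w) pos end =
  bargraphFrom-complete (suc n) w (positiveFrom-∷ (heightFrom-H (suc n)) pos) (trans (sym (heightFrom-H (suc n) w)) end)
bargraphFrom-complete (suc n) (D ∷ w) pos end =
  bargraphFrom-complete n w (positiveFrom-∷ (heightFrom-D n) pos) (trans (sym (heightFrom-D n w)) end)

bargraphFrom-positive : ∀ n w → bargraphFrom n w ≡ true → PositiveFrom n w
bargraphFrom-positive n [] acc [] [] refl s≢[] = ⊥-elim (s≢[] refl)
bargraphFrom-positive (suc n) (x ∷ w) acc [] s eq s≢[] = +<+ (s≤s z≤n)
bargraphFrom-positive (suc n) (U ∷ w) acc (U ∷ p) s refl s≢[] =
  subst (+ 0 ℤ.<_) (sym (heightFrom-U (suc n) p)) (bargraphFrom-positive (suc (suc n)) w acc p s refl s≢[])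
bargraphFrom-positive (suc n) (H ∷ w) acc (H ∷ p) s refl s≢[] =
  subst (+ 0 ℤ.<_) (sym (heightFrom-H (suc n) p)) (bargraphFrom-positive (suc n) w acc p s refl s≢[])
bargraphFrom-positive (suc n) (D ∷ w) acc (D ∷ p) s refl s≢[] =
  subst (+ 0 ℤ.<_) (sym (heightFrom-D n p)) (bargraphFrom-positive n w acc p s refl s≢[])

bargraphFrom-end : ∀ n w → bargraphFrom n w ≡ true → heightFrom n w ≡ + 0
bargraphFrom-end zero [] acc = refl
bargraphFrom-end (suc n) (U ∷ w) acc = trans (heightFrom-U (suc n) w) (bargraphFrom-end (suc (suc n)) w acc)
bargraphFrom-end (suc n) (H ∷ w) acc = trans (heightFrom-H (suc n) w) (bargraphFrom-end (suc n) w acc)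
bargraphFrom-end (suc n) (D ∷ w) acc = trans (heightFrom-D n w) (bargraphFrom-end n w acc)

bargraph⇒bargraphFrom1 : ∀ {w} → Bargraph (U ∷ w) → bargraphFrom 1 w ≡ true
bargraph⇒bargraphFrom1 {w} b = bargraphFrom-complete 1 w
  (λ p s eq s≢[] → Bargraph.strictlyAbove b (U ∷ p) s (cong (U ∷_) eq) (λ ()) s≢[])
  (Bargraph.endsOnAxis b)

-- Forbidden factors as adjacency relations

data KLink : Step → Step → Set where
  UH : KLink U H
  HU : KLink H U
  HH : KLink H H
  HD : KLink H D
  DU : KLink D U
  DH : KLink D H

data BarLink : Step → Step → Set where
  UU : BarLink U U
  UH : BarLink U H
  HU : BarLink H U
  HH : BarLink H H
  HD : BarLink H D
  DH : BarLink D H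
  DD : BarLink D D

linked⇒¬factor : ∀ {R : Step → Step → Set} {a b} → ¬ R a b → ∀ {w} → Linked R w → ¬ HasFactor a b w
linked⇒¬factor ¬Rab l (p , s , refl) = ¬Rab (linked-at p l)
  where
  linked-at : ∀ {R : Step → Step → Set} p {a b s} → Linked R (p ++ a ∷ b ∷ s) → R a b
  linked-at [] (r ∷ _) = r
  linked-at (_ ∷ []) (_ ∷ l) = linked-at [] l
  linked-at (_ ∷ q ∷ p) (_ ∷ l) = linked-at (q ∷ p) l

factors⇒linked : ∀ {R : Step → Step → Set} w → (∀ p a b s → w ≡ p ++ a ∷ b ∷ s → R a b) → Linked R w
factors⇒linked [] h = []
factors⇒linked (_ ∷ []) h = [-]
factors⇒linked (x ∷ y ∷ w) h =
  h [] x y w refl ∷ factors⇒linked (y ∷ w) (λ p a b s eq → h (x ∷ p) a b s (cong (x ∷_) eq))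

InK⇒linked : ∀ {w} → InK w → Linked KLink w
InK⇒linked {w} (_ , ¬UD , ¬UU , ¬DD) = factors⇒linked w link
  where
  link : ∀ p a b s → w ≡ p ++ a ∷ b ∷ s → KLink a b
  link p U U s eq = ⊥-elim (¬UU (p , s , eq))
  link p U D s eq = ⊥-elim (¬UD (p , s , eq))
  link p D D s eq = ⊥-elim (¬DD (p , s , eq))
  link p U H s eq = UH
  link p H U s eq = HU
  link p H H s eq = HH
  link p H D s eq = HD
  link p D U s eq = DU
  link p D H s eq = DH

bargraphFrom1⇒bargraph : ∀ {w} → bargraphFrom 1 w ≡ true → Linked BarLink (U ∷ w) → Bargraph (U ∷ w)
bargraphFrom1⇒bargraph {w} acc l = record
  { nonempty = λ ()
  ; endsOnAxis = bargraphFrom-end 1 w acc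
  ; strictlyAbove = above
  ; noUD = linked⇒¬factor (λ ()) l
  ; noDU = linked⇒¬factor (λ ()) l
  }
  where
  above : ∀ p s → U ∷ w ≡ p ++ s → p ≢ [] → s ≢ [] → + 0 ℤ.< height p
  above [] s eq p≢[] s≢[] = ⊥-elim (p≢[] refl)
  above (U ∷ p) s refl p≢[] s≢[] = bargraphFrom-positive 1 w acc p s refl s≢[]

-- A token (d , u) is the factor D^d U^u; a word of 𝒦 is a sequence of tokens separated by H steps.
Token : Set
Token = Bool × Bool

render : Token → List Step
render (false , false) = []
render (true , false) = D ∷ []
render (false , true) = U ∷ []
render (true , true) = D ∷ U ∷ []

hJoin : List Token → List Step
hJoin [] = []
hJoin (t ∷ ts) = H ∷ render t ++ hJoin ts

join : List Token → List Step
join [] = []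
join (t ∷ ts) = render t ++ hJoin ts

tokenize : List Step → List Token
tokenizeH : List Step → List Token
tokenize [] = (false , false) ∷ []
tokenize (H ∷ w) = (false , false) ∷ tokenize w
tokenize (U ∷ w) = (false , true) ∷ tokenizeH w
tokenize (D ∷ []) = (true , false) ∷ []
tokenize (D ∷ H ∷ w) = (true , false) ∷ tokenize w
tokenize (D ∷ U ∷ w) = (true , true) ∷ tokenizeH w
-- The clause for D D and the last clause of tokenizeH only matter outside 𝒦.
tokenize (D ∷ D ∷ w) = (true , false) ∷ []
tokenizeH (H ∷ w) = tokenize w
tokenizeH _ = []

dBits uBits : List Token → List Bool
dBits ts = proj₁ (unzip ts)
uBits ts = proj₂ (unzip ts)

trues : List Bool → ℕ
trues [] = 0
trues (true ∷ bs) = suc (trues bs)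
trues (false ∷ bs) = trues bs

tokenizeH-hJoin : ∀ ts → tokenizeH (hJoin ts) ≡ ts
tokenizeH-hJoin [] = refl
tokenizeH-hJoin ((false , false) ∷ []) = refl
tokenizeH-hJoin ((false , false) ∷ t ∷ ts) = cong ((false , false) ∷_) (tokenizeH-hJoin (t ∷ ts))
tokenizeH-hJoin ((true , false) ∷ []) = refl
tokenizeH-hJoin ((true , false) ∷ t ∷ ts) = cong ((true , false) ∷_) (tokenizeH-hJoin (t ∷ ts))
tokenizeH-hJoin ((false , true) ∷ ts) = cong ((false , true) ∷_) (tokenizeH-hJoin ts)
tokenizeH-hJoin ((true , true) ∷ ts) = cong ((true , true) ∷_) (tokenizeH-hJoin ts)

tokenize-join : ∀ {ts} → ts ≢ [] → tokenize (join ts) ≡ ts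
tokenize-join {[]} ts≢[] = ⊥-elim (ts≢[] refl)
tokenize-join {t ∷ ts} _ = tokenizeH-hJoin (t ∷ ts)

tokenize-nonempty : ∀ w → tokenize w ≢ []
tokenize-nonempty [] ()
tokenize-nonempty (H ∷ w) ()
tokenize-nonempty (U ∷ w) ()
tokenize-nonempty (D ∷ []) ()
tokenize-nonempty (D ∷ H ∷ w) ()
tokenize-nonempty (D ∷ U ∷ w) ()
tokenize-nonempty (D ∷ D ∷ w) ()

hJoin-nonempty : ∀ {ts} → ts ≢ [] → hJoin ts ≡ H ∷ join ts
hJoin-nonempty {[]} ts≢[] = ⊥-elim (ts≢[] refl)
hJoin-nonempty {t ∷ ts} _ = refl

join-tokenize : ∀ {w} → Linked KLink w → join (tokenize w) ≡ w
hJoin-tokenize-linked : ∀ {w} → Linked KLink (H ∷ w) → hJoin (tokenize w) ≡ H ∷ w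
hJoin-tokenize-linked {w} l = trans (hJoin-nonempty (tokenize-nonempty w)) (cong (H ∷_) (join-tokenize (tail l)))
join-tokenize {[]} _ = refl
join-tokenize {H ∷ w} l = hJoin-tokenize-linked l
join-tokenize {U ∷ []} _ = refl
join-tokenize {U ∷ H ∷ w} (UH ∷ l) = cong (U ∷_) (hJoin-tokenize-linked l)
join-tokenize {D ∷ []} _ = refl
join-tokenize {D ∷ H ∷ w} (DH ∷ l) = cong (D ∷_) (hJoin-tokenize-linked l)
join-tokenize {D ∷ U ∷ []} _ = refl
join-tokenize {D ∷ U ∷ H ∷ w} (DU ∷ UH ∷ l) = cong (λ w′ → D ∷ U ∷ w′) (hJoin-tokenize-linked l)

link-H : ∀ x → KLink x H
link-H U = UH
link-H H = HH
link-H D = DH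

linked-hJoin : ∀ ts → Linked KLink (hJoin ts)
linked-∷hJoin : ∀ x ts → Linked KLink (x ∷ hJoin ts)
linked-∷hJoin x [] = [-]
linked-∷hJoin x (t ∷ ts) = link-H x ∷ linked-hJoin (t ∷ ts)
linked-hJoin [] = []
linked-hJoin ((false , false) ∷ ts) = linked-∷hJoin H ts
linked-hJoin ((true , false) ∷ ts) = HD ∷ linked-∷hJoin D ts
linked-hJoin ((false , true) ∷ ts) = HU ∷ linked-∷hJoin U ts
linked-hJoin ((true , true) ∷ ts) = HD ∷ DU ∷ linked-∷hJoin U ts

linked-join : ∀ ts → Linked KLink (join ts)
linked-join [] = []
linked-join (t ∷ ts) = tail (linked-hJoin (t ∷ ts))

motzkinFrom-join : ∀ n ts → motzkinFrom n (join ts) ≡ motzkinFrom n (hJoin ts)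
motzkinFrom-join n [] = refl
motzkinFrom-join n (t ∷ ts) = refl

#U-hJoin : ∀ ts → #U (hJoin ts) ≡ trues (uBits ts)
#U-hJoin [] = refl
#U-hJoin ((false , false) ∷ ts) = #U-hJoin ts
#U-hJoin ((true , false) ∷ ts) = #U-hJoin ts
#U-hJoin ((false , true) ∷ ts) = cong suc (#U-hJoin ts)
#U-hJoin ((true , true) ∷ ts) = cong suc (#U-hJoin ts)

#D-hJoin : ∀ ts → #D (hJoin ts) ≡ trues (dBits ts)
#D-hJoin [] = refl
#D-hJoin ((false , false) ∷ ts) = #D-hJoin ts
#D-hJoin ((true , false) ∷ ts) = cong suc (#D-hJoin ts)
#D-hJoin ((false , true) ∷ ts) = #D-hJoin ts
#D-hJoin ((true , true) ∷ ts) = cong suc (#D-hJoin ts)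

#H-hJoin : ∀ ts → #H (hJoin ts) ≡ length ts
#H-hJoin [] = refl
#H-hJoin ((false , false) ∷ ts) = cong suc (#H-hJoin ts)
#H-hJoin ((true , false) ∷ ts) = cong suc (#H-hJoin ts)
#H-hJoin ((false , true) ∷ ts) = cong suc (#H-hJoin ts)
#H-hJoin ((true , true) ∷ ts) = cong suc (#H-hJoin ts)

#U-join : ∀ ts → #U (join ts) ≡ trues (uBits ts)
#U-join [] = refl
#U-join (t ∷ ts) = #U-hJoin (t ∷ ts)

#D-join : ∀ ts → #D (join ts) ≡ trues (dBits ts)
#D-join [] = refl
#D-join (t ∷ ts) = #D-hJoin (t ∷ ts)

#H-join : ∀ {ts} → ts ≢ [] → suc (#H (join ts)) ≡ length ts
#H-join {ts} ts≢[] = trans (cong #H (sym (hJoin-nonempty ts≢[]))) (#H-hJoin ts)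

trues-++ : ∀ xs ys → trues (xs ++ ys) ≡ trues xs + trues ys
trues-++ [] ys = refl
trues-++ (true ∷ xs) ys = cong suc (trues-++ xs ys)
trues-++ (false ∷ xs) ys = trues-++ xs ys

trues-falses : ∀ n → trues (replicate n false) ≡ 0
trues-falses zero = refl
trues-falses (suc n) = trues-falses n

Block : Set
Block = ℕ × ℕ

rises falls : List Block → List ℕ
rises bs = proj₁ (unzip bs)
falls bs = proj₂ (unzip bs)

starts : List ℕ → List Bool
starts [] = []
starts (i ∷ is) = true ∷ replicate (pred i) false ++ starts is

-- The j-th token (j ≥ 1) records whether the (j+1)-th U step of the bargraph opens a new
-- U-run (rendered as D) and whether its (j+1)-th D step opens a new D-run (rendered as U).
toTokens : List Block → List Token
toTokens bs = zip (drop 1 (starts (rises bs))) (drop 1 (starts (falls bs)))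

-- runs a us: the run lengths marked by us, the current run having a + 1 elements already.
runs : ℕ → List Bool → List⁺ ℕ
runs a [] = suc a ∷ []
runs a (false ∷ us) = runs (suc a) us
runs a (true ∷ us) = suc a ∷ toList (runs 0 us)

fromTokens : List Token → List⁺ Block
fromTokens ts = List⁺.zip (runs 0 (dBits ts)) (runs 0 (uBits ts))

Positive : List ℕ → Set
Positive = All (1 ≤_)

allPos⇒rises : ∀ {bs} → AllPos bs → Positive (rises bs)
allPos⇒rises [] = []
allPos⇒rises ((p , _) ∷ ap) = p ∷ allPos⇒rises ap

allPos⇒falls : ∀ {bs} → AllPos bs → Positive (falls bs)
allPos⇒falls [] = []
allPos⇒falls ((_ , q) ∷ ap) = q ∷ allPos⇒falls ap

allPos-zip : ∀ {xs ys} → Positive xs → Positive ys → AllPos (zip xs ys)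
allPos-zip [] _ = []
allPos-zip (_ ∷ _) [] = []
allPos-zip (p ∷ ps) (q ∷ qs) = (p , q) ∷ allPos-zip ps qs

positive-runs : ∀ a us → Positive (toList (runs a us))
positive-runs a [] = s≤s z≤n ∷ []
positive-runs a (false ∷ us) = positive-runs (suc a) us
positive-runs a (true ∷ us) = s≤s z≤n ∷ positive-runs 0 us

allPos-fromTokens : ∀ ts → AllPos (toList (fromTokens ts))
allPos-fromTokens ts = allPos-zip (positive-runs 0 (dBits ts)) (positive-runs 0 (uBits ts))

starts-runs : ∀ a us → starts (toList (runs a us)) ≡ true ∷ replicate a false ++ us
starts-runs a [] = refl
starts-runs a (false ∷ us) = trans (starts-runs (suc a) us) (cong (true ∷_) (false-later a))
  where
  false-later : ∀ n → replicate (suc n) false ++ us ≡ replicate n false ++ false ∷ us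
  false-later zero = refl
  false-later (suc n) = cong (false ∷_) (false-later n)
starts-runs a (true ∷ us) = cong (λ w → true ∷ replicate a false ++ w) (starts-runs 0 us)

runs-starts : ∀ a i is → Positive is → runs a (replicate i false ++ starts is) ≡ suc (i + a) ∷ is
runs-starts a (suc i) is pos = trans (runs-starts (suc a) i is pos) (cong (λ n → suc n ∷ is) (ℕP.+-suc i a))
runs-starts a zero [] [] = refl
runs-starts a zero (suc j ∷ is) (_ ∷ pos) =
  cong (λ r → suc a ∷ toList r) (trans (runs-starts 0 j is pos) (cong (λ n → suc n ∷ is) (ℕP.+-identityʳ j)))

length-runs : ∀ a us → length (toList (runs a us)) ≡ suc (trues us)
length-runs a [] = refl
length-runs a (false ∷ us) = length-runs (suc a) us
length-runs a (true ∷ us) = cong suc (length-runs 0 us)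

length-starts : ∀ {is} → Positive is → length (starts is) ≡ sum is
length-starts [] = refl
length-starts {suc i ∷ is} (_ ∷ pos) =
  cong suc (trans (LP.length-++ (replicate i false)) (cong₂ _+_ (LP.length-replicate i) (length-starts pos)))

trues-starts : ∀ is → trues (starts is) ≡ length is
trues-starts [] = refl
trues-starts (i ∷ is) = cong suc (begin
  trues (replicate (pred i) false ++ starts is)         ≡⟨ trues-++ (replicate (pred i) false) (starts is) ⟩
  trues (replicate (pred i) false) + trues (starts is)  ≡⟨ cong₂ _+_ (trues-falses (pred i)) (trues-starts is) ⟩
  length is                                            ∎)

module _ (ts : List Token) (balanced : trues (dBits ts) ≡ trues (uBits ts)) where

  unzip-fromTokens : unzip (toList (fromTokens ts)) ≡ (toList (runs 0 (dBits ts)) , toList (runs 0 (uBits ts)))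
  unzip-fromTokens = LP.unzip-zip _ _
    (trans (length-runs 0 (dBits ts)) (trans (cong suc balanced) (sym (length-runs 0 (uBits ts)))))

  starts-rises-fromTokens : starts (rises (toList (fromTokens ts))) ≡ true ∷ dBits ts
  starts-rises-fromTokens = trans (cong (λ p → starts (proj₁ p)) unzip-fromTokens) (starts-runs 0 (dBits ts))

  starts-falls-fromTokens : starts (falls (toList (fromTokens ts))) ≡ true ∷ uBits ts
  starts-falls-fromTokens = trans (cong (λ p → starts (proj₂ p)) unzip-fromTokens) (starts-runs 0 (uBits ts))

  toTokens-fromTokens : toTokens (toList (fromTokens ts)) ≡ ts
  toTokens-fromTokens = trans
    (cong₂ (λ xs ys → zip (drop 1 xs) (drop 1 ys)) starts-rises-fromTokens starts-falls-fromTokens)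
    (LP.zip-unzip ts)

  sum-rises-fromTokens : sum (rises (toList (fromTokens ts))) ≡ suc (length ts)
  sum-rises-fromTokens = begin
    sum (rises (toList (fromTokens ts)))              ≡⟨ length-starts (allPos⇒rises (allPos-fromTokens ts)) ⟨
    length (starts (rises (toList (fromTokens ts))))  ≡⟨ cong length starts-rises-fromTokens ⟩
    suc (length (dBits ts))                           ≡⟨ cong suc (LP.length-unzipWith₁ id ts) ⟩
    suc (length ts)                                   ∎

  sum-falls-fromTokens : sum (falls (toList (fromTokens ts))) ≡ suc (length ts)
  sum-falls-fromTokens = begin
    sum (falls (toList (fromTokens ts)))              ≡⟨ length-starts (allPos⇒falls (allPos-fromTokens ts)) ⟨
    length (starts (falls (toList (fromTokens ts))))  ≡⟨ cong length starts-falls-fromTokens ⟩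
    suc (length (uBits ts))                           ≡⟨ cong suc (LP.length-unzipWith₂ id ts) ⟩
    suc (length ts)                                   ∎

module Balanced {i k : ℕ} {bs : List Block} (pos : AllPos bs)
                (balanced : suc i + sum (rises bs) ≡ suc k + sum (falls bs)) where

  rest-rises rest-falls : List Bool
  rest-rises = replicate i false ++ starts (rises bs)
  rest-falls = replicate k false ++ starts (falls bs)

  length-rest-rises : length rest-rises ≡ i + sum (rises bs)
  length-rest-rises = trans (LP.length-++ (replicate i false))
    (cong₂ _+_ (LP.length-replicate i) (length-starts (allPos⇒rises pos)))

  length-rest-falls : length rest-falls ≡ k + sum (falls bs)
  length-rest-falls = trans (LP.length-++ (replicate k false))
    (cong₂ _+_ (LP.length-replicate k) (length-starts (allPos⇒falls pos)))

  same-length : length rest-rises ≡ length rest-falls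
  same-length = trans length-rest-rises (trans (ℕP.suc-injective balanced) (sym length-rest-falls))

  unzip-toTokens : unzip (toTokens ((suc i , suc k) ∷ bs)) ≡ (rest-rises , rest-falls)
  unzip-toTokens = LP.unzip-zip rest-rises rest-falls same-length

  fromTokens-toTokens : fromTokens (toTokens ((suc i , suc k) ∷ bs)) ≡ (suc i , suc k) ∷ bs
  fromTokens-toTokens = begin
    fromTokens (toTokens ((suc i , suc k) ∷ bs))
      ≡⟨ cong (λ p → List⁺.zip (runs 0 (proj₁ p)) (runs 0 (proj₂ p))) unzip-toTokens ⟩
    List⁺.zip (runs 0 rest-rises) (runs 0 rest-falls)
      ≡⟨ cong₂ List⁺.zip (runs-starts 0 i (rises bs) (allPos⇒rises pos)) (runs-starts 0 k (falls bs) (allPos⇒falls pos)) ⟩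
    List⁺.zip (suc (i + 0) ∷ rises bs) (suc (k + 0) ∷ falls bs)
      ≡⟨ cong₂ (λ m n → (suc m , suc n) ∷ zip (rises bs) (falls bs)) (ℕP.+-identityʳ i) (ℕP.+-identityʳ k) ⟩
    (suc i , suc k) ∷ zip (rises bs) (falls bs)
      ≡⟨ cong ((suc i , suc k) ∷_) (LP.zip-unzip bs) ⟩
    (suc i , suc k) ∷ bs ∎

  length-toTokens : length (toTokens ((suc i , suc k) ∷ bs)) ≡ i + sum (rises bs)
  length-toTokens = begin
    length (zip rest-rises rest-falls)           ≡⟨ LP.length-zipWith _,_ rest-rises rest-falls ⟩
    length rest-rises ⊓ length rest-falls        ≡⟨ cong (length rest-rises ⊓_) (sym same-length) ⟩
    length rest-rises ⊓ length rest-rises        ≡⟨ ℕP.⊓-idem (length rest-rises) ⟩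
    length rest-rises                            ≡⟨ length-rest-rises ⟩
    i + sum (rises bs)                           ∎

  trues-dBits-toTokens : trues (dBits (toTokens ((suc i , suc k) ∷ bs))) ≡ length bs
  trues-dBits-toTokens = trans (cong (λ p → trues (proj₁ p)) unzip-toTokens)
    (trans (ℕP.suc-injective (trues-starts (rises ((suc i , suc k) ∷ bs)))) (LP.length-unzipWith₁ id bs))

  trues-uBits-toTokens : trues (uBits (toTokens ((suc i , suc k) ∷ bs))) ≡ length bs
  trues-uBits-toTokens = trans (cong (λ p → trues (proj₂ p)) unzip-toTokens)
    (trans (ℕP.suc-injective (trues-starts (falls ((suc i , suc k) ∷ bs)))) (LP.length-unzipWith₂ id bs))

-- validBlock i k bs: the blocks (i , k) ∷ bs describe a bargraph;
-- validFrom h bs: the blocks bs continue a bargraph whose last column has height h.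
validBlock : ℕ → ℕ → List Block → Bool
validFrom : ℕ → List Block → Bool
validBlock i k bs = (k ≤ᵇ i) ∧ validFrom (i ∸ k) bs
validFrom zero [] = true
validFrom (suc h) [] = false
validFrom zero (_ ∷ _) = false
validFrom (suc h) ((i , k) ∷ bs) = validBlock (suc h + i) k bs

validBlock-suc : ∀ m k bs → validBlock (suc m) (suc k) bs ≡ validBlock m k bs
validBlock-suc m zero bs = refl
validBlock-suc m (suc k) bs = refl

∧-true : ∀ {a b} → a ∧ b ≡ true → a ≡ true × b ≡ true
∧-true {true} {true} refl = refl , refl

validFrom-balanced : ∀ h bs → validFrom h bs ≡ true → h + sum (rises bs) ≡ sum (falls bs)
validBlock-balanced : ∀ i k bs → validBlock i k bs ≡ true → i + sum (rises bs) ≡ k + sum (falls bs)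
validBlock-balanced i k bs ok with ∧-true {k ≤ᵇ i} ok
... | k≤ᵇi , rest-ok = begin
  i + sum (rises bs)             ≡⟨ cong (_+ sum (rises bs)) (sym (ℕP.m+[n∸m]≡n k≤i)) ⟩
  k + (i ∸ k) + sum (rises bs)   ≡⟨ ℕP.+-assoc k (i ∸ k) (sum (rises bs)) ⟩
  k + (i ∸ k + sum (rises bs))   ≡⟨ cong (_+_ k) (validFrom-balanced (i ∸ k) bs rest-ok) ⟩
  k + sum (falls bs)             ∎
  where
  k≤i : k ≤ i
  k≤i = ℕP.≤ᵇ⇒≤ k i (subst T (sym k≤ᵇi) _)
validFrom-balanced zero [] ok = refl
validFrom-balanced (suc h) ((i , k) ∷ bs) ok =
  trans (sym (ℕP.+-assoc (suc h) i (sum (rises bs)))) (validBlock-balanced (suc h + i) k bs ok)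

motzkin-consume : ∀ j V {Y Z} → j ≤ length V →
  motzkinFrom (trues V) (hJoin (zip (V ++ Y) (replicate j false ++ Z)))
  ≡ motzkinFrom (trues (drop j V)) (hJoin (zip (drop j V ++ Y) Z))
motzkin-consume zero V _ = refl
motzkin-consume (suc j) (true ∷ V) (s≤s j≤V) = motzkin-consume j V j≤V
motzkin-consume (suc j) (false ∷ V) (s≤s j≤V) = motzkin-consume j V j≤V

motzkin-overrun : ∀ j V {Y Z} → length V < j →
  motzkinFrom (trues V) (hJoin (zip (V ++ true ∷ Y) (replicate j false ++ Z))) ≡ false
motzkin-overrun (suc j) [] _ = refl
motzkin-overrun (suc j) (true ∷ V) (s≤s V<j) = motzkin-overrun j V V<j
motzkin-overrun (suc j) (false ∷ V) (s≤s V<j) = motzkin-overrun j V V<j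

-- The lag q is the part of the rise stream read ahead of the fall stream: its length is the
-- height of the current column of the bargraph, its number of trues the height of the Motzkin path.
motzkin-lag : ∀ q bs → AllPos bs → length q + sum (rises bs) ≡ sum (falls bs) →
  motzkinFrom (trues q) (hJoin (zip (q ++ starts (rises bs)) (starts (falls bs)))) ≡ validFrom (length q) bs
motzkin-block : ∀ V k bs → AllPos bs → length V + sum (rises bs) ≡ k + sum (falls bs) →
  motzkinFrom (trues V) (hJoin (zip (V ++ starts (rises bs)) (replicate k false ++ starts (falls bs))))
  ≡ validBlock (length V) k bs

motzkin-lag [] [] _ _ = refl
motzkin-lag [] (_ ∷ _) _ _ = refl
motzkin-lag (w ∷ q) ((suc i , suc k) ∷ bs) ((s≤s z≤n , s≤s z≤n) ∷ pos) balanced = begin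
  motzkinFrom (trues (w ∷ q)) (hJoin ((w , true) ∷ zip (q ++ V′ ++ R) (replicate k false ++ F)))
    ≡⟨ opens-column w ⟩
  motzkinFrom (suc (trues q)) (hJoin (zip (q ++ V′ ++ R) (replicate k false ++ F)))
    ≡⟨ cong₂ (λ n xs → motzkinFrom n (hJoin (zip xs (replicate k false ++ F)))) (sym trues-V) (sym (LP.++-assoc q V′ R)) ⟩
  motzkinFrom (trues V) (hJoin (zip (V ++ R) (replicate k false ++ F)))
    ≡⟨ motzkin-block V k bs pos balanced-V ⟩
  validBlock (length V) k bs
    ≡⟨ cong (λ n → validBlock n k bs) length-V ⟩
  validBlock (length q + suc i) k bs
    ≡⟨ validBlock-suc (length q + suc i) k bs ⟨
  validBlock (suc (length q + suc i)) (suc k) bs ∎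
  where
  R = starts (rises bs)
  F = starts (falls bs)
  V′ = true ∷ replicate i false
  V = q ++ V′
  opens-column : ∀ w {rest} →
    motzkinFrom (trues (w ∷ q)) (hJoin ((w , true) ∷ rest)) ≡ motzkinFrom (suc (trues q)) (hJoin rest)
  opens-column true = refl
  opens-column false = refl
  trues-V : trues V ≡ suc (trues q)
  trues-V = begin
    trues (q ++ V′)                  ≡⟨ trues-++ q V′ ⟩
    trues q + suc (trues (replicate i false)) ≡⟨ cong (λ n → trues q + suc n) (trues-falses i) ⟩
    trues q + 1                      ≡⟨ ℕP.+-comm (trues q) 1 ⟩
    suc (trues q)                    ∎
  length-V : length V ≡ length q + suc i
  length-V = trans (LP.length-++ q) (cong (λ n → length q + suc n) (LP.length-replicate i))
  balanced-V : length V + sum (rises bs) ≡ k + sum (falls bs)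
  balanced-V = begin
    length V + sum (rises bs)            ≡⟨ cong (_+ sum (rises bs)) length-V ⟩
    length q + suc i + sum (rises bs)    ≡⟨ ℕP.+-assoc (length q) (suc i) (sum (rises bs)) ⟩
    length q + (suc i + sum (rises bs))  ≡⟨ ℕP.suc-injective balanced ⟩
    k + sum (falls bs)                   ∎
motzkin-block V k bs pos balanced with k ≤ᵇ length V | ℕP.≤ᵇ-reflects-≤ k (length V)
... | true | ofʸ k≤V = begin
  motzkinFrom (trues V) (hJoin (zip (V ++ starts (rises bs)) (replicate k false ++ starts (falls bs))))
    ≡⟨ motzkin-consume k V k≤V ⟩
  motzkinFrom (trues (drop k V)) (hJoin (zip (drop k V ++ starts (rises bs)) (starts (falls bs))))
    ≡⟨ motzkin-lag (drop k V) bs pos balanced-lag ⟩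
  validFrom (length (drop k V)) bs
    ≡⟨ cong (λ n → validFrom n bs) (LP.length-drop k V) ⟩
  validFrom (length V ∸ k) bs ∎
  where
  balanced-lag : length (drop k V) + sum (rises bs) ≡ sum (falls bs)
  balanced-lag = ℕP.+-cancelˡ-≡ k _ _ (begin
    k + (length (drop k V) + sum (rises bs))  ≡⟨ cong (λ n → k + (n + sum (rises bs))) (LP.length-drop k V) ⟩
    k + (length V ∸ k + sum (rises bs))       ≡⟨ ℕP.+-assoc k (length V ∸ k) (sum (rises bs)) ⟨
    k + (length V ∸ k) + sum (rises bs)       ≡⟨ cong (_+ sum (rises bs)) (ℕP.m+[n∸m]≡n k≤V) ⟩
    length V + sum (rises bs)                 ≡⟨ balanced ⟩
    k + sum (falls bs)                        ∎)
... | false | ofⁿ k≰V = overrun bs balanced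
  where
  overrun : ∀ bs → length V + sum (rises bs) ≡ k + sum (falls bs) →
            motzkinFrom (trues V) (hJoin (zip (V ++ starts (rises bs)) (replicate k false ++ starts (falls bs)))) ≡ false
  overrun [] balanced =
    ⊥-elim (k≰V (subst (k ≤_) (ℕP.+-identityʳ (length V)) (ℕP.m+n≤o⇒m≤o k (ℕP.≤-reflexive (sym balanced)))))
  overrun (_ ∷ _) _ = motzkin-overrun k V (ℕP.≰⇒> k≰V)

motzkin-toTokens : ∀ i k bs → AllPos bs → suc i + sum (rises bs) ≡ suc k + sum (falls bs) →
  motzkinFrom 0 (hJoin (toTokens ((suc i , suc k) ∷ bs))) ≡ validBlock (suc i) (suc k) bs
motzkin-toTokens i k bs pos balanced = begin
  motzkinFrom 0 (hJoin tokens)           ≡⟨ cong (λ n → motzkinFrom n (hJoin tokens)) (trues-falses i) ⟨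
  motzkinFrom (trues V) (hJoin tokens)   ≡⟨ motzkin-block V k bs pos balanced-V ⟩
  validBlock (length V) k bs             ≡⟨ cong (λ n → validBlock n k bs) (LP.length-replicate i) ⟩
  validBlock i k bs                      ≡⟨ validBlock-suc i k bs ⟨
  validBlock (suc i) (suc k) bs          ∎
  where
  tokens = toTokens ((suc i , suc k) ∷ bs)
  V = replicate i false
  balanced-V : length V + sum (rises bs) ≡ k + sum (falls bs)
  balanced-V = trans (cong (_+ sum (rises bs)) (LP.length-replicate i)) (ℕP.suc-injective balanced)

hSaWord : List Block → List Step
hSaWord [] = []
hSaWord (c ∷ cs) = H ∷ saWord' c cs

saWord'-blocks : ∀ i k bs → saWord' (i , k) bs ≡ replicate i U ++ H ∷ replicate k D ++ hSaWord bs
saWord'-blocks i k [] = cong (λ w → replicate i U ++ H ∷ w) (sym (LP.++-identityʳ (replicate k D)))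
saWord'-blocks i k (c ∷ cs) = LP.++-assoc (replicate i U) (H ∷ replicate k D) (H ∷ saWord' c cs)

bargraphFrom-Us : ∀ n j w → bargraphFrom (suc n) (replicate j U ++ w) ≡ bargraphFrom (suc n + j) w
bargraphFrom-Us n zero w = cong (λ m → bargraphFrom (suc m) w) (sym (ℕP.+-identityʳ n))
bargraphFrom-Us n (suc j) w = trans (bargraphFrom-Us (suc n) j w) (cong (λ m → bargraphFrom (suc m) w) (sym (ℕP.+-suc n j)))

bargraphFrom-hSaWord : ∀ h bs → bargraphFrom h (hSaWord bs) ≡ validFrom h bs
bargraphFrom-Ds : ∀ h k bs → bargraphFrom h (replicate k D ++ hSaWord bs) ≡ validBlock h k bs
bargraphFrom-Ds h zero bs = bargraphFrom-hSaWord h bs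
bargraphFrom-Ds zero (suc k) bs = refl
bargraphFrom-Ds (suc h) (suc k) bs = trans (bargraphFrom-Ds h k bs) (sym (validBlock-suc h k bs))
bargraphFrom-hSaWord zero [] = refl
bargraphFrom-hSaWord (suc h) [] = refl
bargraphFrom-hSaWord zero (_ ∷ _) = refl
bargraphFrom-hSaWord (suc h) ((i , k) ∷ bs) = begin
  bargraphFrom (suc h) (saWord' (i , k) bs)                                  ≡⟨ cong (bargraphFrom (suc h)) (saWord'-blocks i k bs) ⟩
  bargraphFrom (suc h) (replicate i U ++ H ∷ replicate k D ++ hSaWord bs)    ≡⟨ bargraphFrom-Us h i _ ⟩
  bargraphFrom (suc h + i) (replicate k D ++ hSaWord bs)                     ≡⟨ bargraphFrom-Ds (suc h + i) k bs ⟩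
  validBlock (suc h + i) k bs                                                ∎

bargraphFrom-saWord : ∀ i k bs →
  bargraphFrom 1 (replicate i U ++ H ∷ replicate k D ++ hSaWord bs) ≡ validBlock (suc i) k bs
bargraphFrom-saWord i k bs = trans (bargraphFrom-Us 0 i _) (bargraphFrom-Ds (suc i) k bs)

link-from-H : ∀ y → BarLink H y
link-from-H U = HU
link-from-H H = HH
link-from-H D = HD

linked-H∷ : ∀ {w} → Linked BarLink w → Linked BarLink (H ∷ w)
linked-H∷ [] = [-]
linked-H∷ {y ∷ _} l = link-from-H y ∷ l

linked-Us : ∀ i {w} → Linked BarLink (H ∷ w) → Linked BarLink (replicate i U ++ H ∷ w)
linked-Us zero l = l
linked-Us (suc zero) l = UH ∷ l
linked-Us (suc (suc i)) l = UU ∷ linked-Us (suc i) l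

linked-hSaWord : ∀ bs → Linked BarLink (hSaWord bs)
linked-Ds : ∀ k bs → Linked BarLink (replicate k D ++ hSaWord bs)
linked-Ds zero bs = linked-hSaWord bs
linked-Ds (suc zero) [] = [-]
linked-Ds (suc zero) (c ∷ cs) = DH ∷ linked-hSaWord (c ∷ cs)
linked-Ds (suc (suc k)) bs = DD ∷ linked-Ds (suc k) bs
linked-hSaWord [] = []
linked-hSaWord ((i , k) ∷ bs) =
  linked-H∷ (subst (Linked BarLink) (sym (saWord'-blocks i k bs)) (linked-Us i (linked-H∷ (linked-Ds k bs))))

linked-saWord' : ∀ b bs → Linked BarLink (saWord' b bs)
linked-saWord' b bs = tail (linked-hSaWord (b ∷ bs))

#U-Us : ∀ i w → #U (replicate i U ++ w) ≡ i + #U w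
#U-Us zero w = refl
#U-Us (suc i) w = cong suc (#U-Us i w)

#U-Ds : ∀ k w → #U (replicate k D ++ w) ≡ #U w
#U-Ds zero w = refl
#U-Ds (suc k) w = #U-Ds k w

#H-Us : ∀ i w → #H (replicate i U ++ w) ≡ #H w
#H-Us zero w = refl
#H-Us (suc i) w = #H-Us i w

#H-Ds : ∀ k w → #H (replicate k D ++ w) ≡ #H w
#H-Ds zero w = refl
#H-Ds (suc k) w = #H-Ds k w

#U-hSaWord : ∀ bs → #U (hSaWord bs) ≡ sum (rises bs)
#U-saWord' : ∀ i k bs → #U (saWord' (i , k) bs) ≡ i + sum (rises bs)
#U-saWord' i k bs = begin
  #U (saWord' (i , k) bs)                                   ≡⟨ cong #U (saWord'-blocks i k bs) ⟩
  #U (replicate i U ++ H ∷ replicate k D ++ hSaWord bs)     ≡⟨ #U-Us i _ ⟩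
  i + #U (replicate k D ++ hSaWord bs)                      ≡⟨ cong (_+_ i) (trans (#U-Ds k _) (#U-hSaWord bs)) ⟩
  i + sum (rises bs)                                        ∎
#U-hSaWord [] = refl
#U-hSaWord ((i , k) ∷ bs) = #U-saWord' i k bs

#H-hSaWord : ∀ bs → #H (hSaWord bs) ≡ length bs + length bs
#H-saWord' : ∀ i k bs → #H (saWord' (i , k) bs) ≡ suc (length bs + length bs)
#H-saWord' i k bs = begin
  #H (saWord' (i , k) bs)                                   ≡⟨ cong #H (saWord'-blocks i k bs) ⟩
  #H (replicate i U ++ H ∷ replicate k D ++ hSaWord bs)     ≡⟨ #H-Us i _ ⟩
  suc (#H (replicate k D ++ hSaWord bs))                    ≡⟨ cong suc (trans (#H-Ds k _) (#H-hSaWord bs)) ⟩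
  suc (length bs + length bs)                               ∎
#H-hSaWord [] = refl
#H-hSaWord ((i , k) ∷ bs) = cong suc (trans (#H-saWord' i k bs) (sym (ℕP.+-suc (length bs) (length bs))))

-- readRises i w and readFalls i k w resume reading U^i and U^i H D^k respectively.
readRises : ℕ → List Step → List Block
readFalls : ℕ → ℕ → List Step → List Block
readRises i (U ∷ w) = readRises (suc i) w
readRises i (H ∷ w) = readFalls i 0 w
readRises i _ = []
readFalls i k [] = (i , k) ∷ []
readFalls i k (D ∷ w) = readFalls i (suc k) w
readFalls i k (H ∷ w) = (i , k) ∷ readRises 0 w
readFalls i k (U ∷ w) = []

blocksOf : List Step → List Block
blocksOf = readRises 0

readRises-Us : ∀ i j w → readRises i (replicate j U ++ w) ≡ readRises (i + j) w
readRises-Us i zero w = cong (λ n → readRises n w) (sym (ℕP.+-identityʳ i))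
readRises-Us i (suc j) w = trans (readRises-Us (suc i) j w) (cong (λ n → readRises n w) (sym (ℕP.+-suc i j)))

readFalls-Ds : ∀ i k j w → readFalls i k (replicate j D ++ w) ≡ readFalls i (k + j) w
readFalls-Ds i k zero w = cong (λ n → readFalls i n w) (sym (ℕP.+-identityʳ k))
readFalls-Ds i k (suc j) w = trans (readFalls-Ds i (suc k) j w) (cong (λ n → readFalls i n w) (sym (ℕP.+-suc k j)))

blocksOf-saWord' : ∀ b bs → blocksOf (saWord' b bs) ≡ b ∷ bs
blocksOf-saWord' (i , k) bs = begin
  readRises 0 (saWord' (i , k) bs)                                   ≡⟨ cong (readRises 0) (saWord'-blocks i k bs) ⟩
  readRises 0 (replicate i U ++ H ∷ replicate k D ++ hSaWord bs)     ≡⟨ readRises-Us 0 i _ ⟩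
  readFalls i 0 (replicate k D ++ hSaWord bs)                        ≡⟨ readFalls-Ds i 0 k (hSaWord bs) ⟩
  readFalls i k (hSaWord bs)                                         ≡⟨ readFalls-hSaWord bs ⟩
  (i , k) ∷ bs                                                       ∎
  where
  readFalls-hSaWord : ∀ bs → readFalls i k (hSaWord bs) ≡ (i , k) ∷ bs
  readFalls-hSaWord [] = refl
  readFalls-hSaWord (c ∷ cs) = cong ((i , k) ∷_) (blocksOf-saWord' c cs)

blocksOf-saWord : ∀ bs⁺ → blocksOf (saWord bs⁺) ≡ toList bs⁺
blocksOf-saWord (b ∷ bs) = blocksOf-saWord' b bs

semiperimeter≡length+3 : ∀ G P → #U P + #D P + 1 ≡ #H G → #H P + 2 ≡ #U G → semiperimeter G ≡ length P + 3
semiperimeter≡length+3 G P #UD #HP = begin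
  #U G + #H G                              ≡⟨ cong₂ _+_ #HP #UD ⟨
  (#H P + 2) + (#U P + #D P + 1)           ≡⟨ rearrange (#U P) (#H P) (#D P) ⟩
  #U P + #H P + #D P + 3                   ≡⟨ cong (_+ 3) (length≡#U+#H+#D P) ⟨
  length P + 3                             ∎
  where
  rearrange : ∀ u h d → (h + 2) + (u + d + 1) ≡ u + h + d + 3
  rearrange = solve-∀

record SABBlocks (G : List Step) : Set where
  field
    i k : ℕ
    bs : List Block
    pos : AllPos bs
    word : G ≡ saWord' (suc i , suc k) bs
    valid : validBlock (suc i) (suc k) bs ≡ true
    -- G has at least two U steps, that is G ≢ UHD
    long : 1 ≤ i + sum (rises bs)

  balanced : suc i + sum (rises bs) ≡ suc k + sum (falls bs)
  balanced = validBlock-balanced (suc i) (suc k) bs valid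

  tokens : List Token
  tokens = toTokens ((suc i , suc k) ∷ bs)

  length-tokens : length tokens ≡ i + sum (rises bs)
  length-tokens = Balanced.length-toTokens pos balanced

  tokens-nonempty : tokens ≢ []
  tokens-nonempty ts≡[] with subst (1 ≤_) (trans (sym length-tokens) (cong length ts≡[])) long
  ... | ()

sab⇒blocks : ∀ {G} → SAB G → SABBlocks G
sab⇒blocks (bar , ((suc i , suc k) ∷ bs , (s≤s z≤n , s≤s z≤n) ∷ pos , refl) , ≢UHD) = record
  { i = i ; k = k ; bs = bs ; pos = pos ; word = refl ; valid = valid ; long = long i k bs pos valid ≢UHD }
  where
  valid : validBlock (suc i) (suc k) bs ≡ true
  valid = trans (sym (bargraphFrom-saWord i (suc k) bs))
                (bargraph⇒bargraphFrom1 (subst Bargraph (saWord'-blocks (suc i) (suc k) bs) bar))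
  long : ∀ i k bs → AllPos bs → validBlock (suc i) (suc k) bs ≡ true →
         saWord' (suc i , suc k) bs ≢ U ∷ H ∷ D ∷ [] → 1 ≤ i + sum (rises bs)
  long (suc i) k bs _ _ _ = s≤s z≤n
  long zero k ((suc _ , _) ∷ _) ((s≤s z≤n , _) ∷ _) _ _ = s≤s z≤n
  long zero zero [] [] _ ≢UHD = ⊥-elim (≢UHD refl)
  long zero (suc k) [] [] () _

validBlocks : List⁺ Block → Bool
validBlocks ((i , k) ∷ bs) = validBlock i k bs

motzkin-toTokens⁺ : ∀ bs⁺ → AllPos (toList bs⁺) → sum (rises (toList bs⁺)) ≡ sum (falls (toList bs⁺)) →
                    motzkinFrom 0 (hJoin (toTokens (toList bs⁺))) ≡ validBlocks bs⁺
motzkin-toTokens⁺ ((suc i , suc k) ∷ bs) ((s≤s z≤n , s≤s z≤n) ∷ pos) = motzkin-toTokens i k bs pos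

blocks⇒sab : ∀ bs⁺ → AllPos (toList bs⁺) → validBlocks bs⁺ ≡ true → 2 ≤ sum (rises (toList bs⁺)) →
             SAB (saWord bs⁺)
blocks⇒sab bs⁺@((suc i , suc k) ∷ bs) pos@((s≤s z≤n , s≤s z≤n) ∷ _) valid long =
  bargraph , (bs⁺ , pos , refl) , ≢UHD
  where
  bargraph : Bargraph (saWord bs⁺)
  bargraph = subst Bargraph (sym (saWord'-blocks (suc i) (suc k) bs))
    (bargraphFrom1⇒bargraph (trans (bargraphFrom-saWord i (suc k) bs) valid)
      (subst (Linked BarLink) (saWord'-blocks (suc i) (suc k) bs) (linked-saWord' (suc i , suc k) bs)))
  ≢UHD : saWord bs⁺ ≢ U ∷ H ∷ D ∷ []
  ≢UHD eq with subst (2 ≤_) (trans (sym (#U-saWord' (suc i) (suc k) bs)) (cong #U eq)) long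
  ... | s≤s ()

InK-join : ∀ ts → motzkinFrom 0 (hJoin ts) ≡ true → InK (join ts)
InK-join ts motzkin =
  motzkinFrom0⇒motzkin (trans (motzkinFrom-join 0 ts) motzkin) ,
  linked⇒¬factor (λ ()) (linked-join ts) ,
  linked⇒¬factor (λ ()) (linked-join ts) ,
  linked⇒¬factor (λ ()) (linked-join ts)

sabToK : List Step → List Step
sabToK G = join (toTokens (blocksOf G))

kToSab : List Step → List Step
kToSab P = saWord (fromTokens (tokenize P))

module FromSAB {G} (sab : SAB G) where
  open SABBlocks (sab⇒blocks sab)

  sabToK≡ : sabToK G ≡ join tokens
  sabToK≡ = trans (cong sabToK word) (cong (λ bs → join (toTokens bs)) (blocksOf-saWord' (suc i , suc k) bs))

  InK-sabToK : InK (sabToK G)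
  InK-sabToK = subst InK (sym sabToK≡) (InK-join tokens (trans (motzkin-toTokens i k bs pos balanced) valid))

  #U-sabToK : #U (sabToK G) ≡ length bs
  #U-sabToK = trans (cong #U sabToK≡) (trans (#U-join tokens) (Balanced.trues-uBits-toTokens pos balanced))

  #D-sabToK : #D (sabToK G) ≡ length bs
  #D-sabToK = trans (cong #D sabToK≡) (trans (#D-join tokens) (Balanced.trues-dBits-toTokens pos balanced))

  #UD-sabToK : #U (sabToK G) + #D (sabToK G) + 1 ≡ #H G
  #UD-sabToK = begin
    #U (sabToK G) + #D (sabToK G) + 1    ≡⟨ cong₂ (λ u d → u + d + 1) #U-sabToK #D-sabToK ⟩
    length bs + length bs + 1            ≡⟨ ℕP.+-comm (length bs + length bs) 1 ⟩
    suc (length bs + length bs)          ≡⟨ #H-saWord' (suc i) (suc k) bs ⟨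
    #H (saWord' (suc i , suc k) bs)      ≡⟨ cong #H word ⟨
    #H G                                 ∎

  #H-sabToK : #H (sabToK G) + 2 ≡ #U G
  #H-sabToK = begin
    #H (sabToK G) + 2                    ≡⟨ ℕP.+-comm (#H (sabToK G)) 2 ⟩
    suc (suc (#H (sabToK G)))            ≡⟨ cong (λ w → suc (suc (#H w))) sabToK≡ ⟩
    suc (suc (#H (join tokens)))         ≡⟨ cong suc (#H-join tokens-nonempty) ⟩
    suc (length tokens)                  ≡⟨ cong suc length-tokens ⟩
    suc i + sum (rises bs)               ≡⟨ #U-saWord' (suc i) (suc k) bs ⟨
    #U (saWord' (suc i , suc k) bs)      ≡⟨ cong #U word ⟨
    #U G                                 ∎

  kToSab-sabToK : kToSab (sabToK G) ≡ G
  kToSab-sabToK = begin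
    kToSab (sabToK G)                         ≡⟨ cong kToSab sabToK≡ ⟩
    saWord (fromTokens (tokenize (join tokens))) ≡⟨ cong (λ ts → saWord (fromTokens ts)) (tokenize-join tokens-nonempty) ⟩
    saWord (fromTokens tokens)                ≡⟨ cong saWord (Balanced.fromTokens-toTokens pos balanced) ⟩
    saWord' (suc i , suc k) bs                ≡⟨ word ⟨
    G                                         ∎

  length-sabToK : ∀ {n} → semiperimeter G ≡ n → length (sabToK G) ≡ n ∸ 3
  length-sabToK refl = begin
    length (sabToK G)                    ≡⟨ ℕP.m+n∸n≡m (length (sabToK G)) 3 ⟨
    length (sabToK G) + 3 ∸ 3            ≡⟨ cong (_∸ 3) (semiperimeter≡length+3 G (sabToK G) #UD-sabToK #H-sabToK) ⟨
    semiperimeter G ∸ 3                  ∎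

sabToK-injective : ∀ G G′ → SAB G → SAB G′ → sabToK G ≡ sabToK G′ → G ≡ G′
sabToK-injective G G′ sab sab′ eq = begin
  G                     ≡⟨ FromSAB.kToSab-sabToK sab ⟨
  kToSab (sabToK G)     ≡⟨ cong kToSab eq ⟩
  kToSab (sabToK G′)    ≡⟨ FromSAB.kToSab-sabToK sab′ ⟩
  G′                    ∎

module FromK {P} (inK : InK P) where
  private
    ts = tokenize P
    motzkin = motzkin⇒motzkinFrom0 (proj₁ inK)

  join-tokenize-P : join ts ≡ P
  join-tokenize-P = join-tokenize (InK⇒linked inK)

  trues-balanced : trues (dBits ts) ≡ trues (uBits ts)
  trues-balanced = begin
    trues (dBits ts)     ≡⟨ #D-join ts ⟨
    #D (join ts)         ≡⟨ cong #D join-tokenize-P ⟩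
    #D P                 ≡⟨ motzkinFrom-balance 0 P motzkin ⟨
    #U P                 ≡⟨ cong #U join-tokenize-P ⟨
    #U (join ts)         ≡⟨ #U-join ts ⟩
    trues (uBits ts)     ∎

  sums-balanced : sum (rises (toList (fromTokens ts))) ≡ sum (falls (toList (fromTokens ts)))
  sums-balanced = trans (sum-rises-fromTokens ts trues-balanced) (sym (sum-falls-fromTokens ts trues-balanced))

  valid : validBlocks (fromTokens ts) ≡ true
  valid = begin
    validBlocks (fromTokens ts)
      ≡⟨ motzkin-toTokens⁺ (fromTokens ts) (allPos-fromTokens ts) sums-balanced ⟨
    motzkinFrom 0 (hJoin (toTokens (toList (fromTokens ts))))
      ≡⟨ cong (λ ts′ → motzkinFrom 0 (hJoin ts′)) (toTokens-fromTokens ts trues-balanced) ⟩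
    motzkinFrom 0 (hJoin ts)    ≡⟨ motzkinFrom-join 0 ts ⟨
    motzkinFrom 0 (join ts)     ≡⟨ cong (motzkinFrom 0) join-tokenize-P ⟩
    motzkinFrom 0 P             ≡⟨ motzkin ⟩
    true                        ∎

  SAB-kToSab : SAB (kToSab P)
  SAB-kToSab = blocks⇒sab (fromTokens ts) (allPos-fromTokens ts) valid
    (subst (2 ≤_) (sym (sum-rises-fromTokens ts trues-balanced)) (s≤s (nonempty⇒length≥1 (tokenize-nonempty P))))
    where
    nonempty⇒length≥1 : ∀ {ts′ : List Token} → ts′ ≢ [] → 1 ≤ length ts′
    nonempty⇒length≥1 {[]} ne = ⊥-elim (ne refl)
    nonempty⇒length≥1 {_ ∷ _} _ = s≤s z≤n

  sabToK-kToSab : sabToK (kToSab P) ≡ P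
  sabToK-kToSab = begin
    join (toTokens (blocksOf (saWord (fromTokens ts))))  ≡⟨ cong (λ bs → join (toTokens bs)) (blocksOf-saWord (fromTokens ts)) ⟩
    join (toTokens (toList (fromTokens ts)))            ≡⟨ cong join (toTokens-fromTokens ts trues-balanced) ⟩
    join ts                                             ≡⟨ join-tokenize-P ⟩
    P                                                   ∎

  semiperimeter-kToSab : ∀ {n} → 3 ≤ n → length P ≡ n ∸ 3 → semiperimeter (kToSab P) ≡ n
  semiperimeter-kToSab {n} 3≤n |P| = begin
    semiperimeter (kToSab P)          ≡⟨ semiperimeter≡length+3 (kToSab P) (sabToK (kToSab P)) #UD-sabToK #H-sabToK ⟩
    length (sabToK (kToSab P)) + 3    ≡⟨ cong (λ w → length w + 3) sabToK-kToSab ⟩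
    length P + 3                      ≡⟨ cong (_+ 3) |P| ⟩
    n ∸ 3 + 3                         ≡⟨ ℕP.m∸n+n≡m 3≤n ⟩
    n                                 ∎
    where open FromSAB SAB-kToSab using (#UD-sabToK; #H-sabToK)

mainTheorem20 : Σ (List Step → List Step) λ f → (
    (∀ (G : List Step) → SAB G → InK (f G)
    × (#U (f G) + #D (f G) + 1 ≡ #H G)
    × (#H (f G) + 2 ≡ #U G))
    × (∀ (G G′ : List Step) → SAB G → SAB G′ → f G ≡ f G′ → G ≡ G′)
    × (∀ (P : List Step) → InK P → Σ (List Step) λ G → (SAB G × f G ≡ P))
    × (∀ (n : ℕ) → 3 ≤ n →
    (∀ (G : List Step) → SAB G → semiperimeter G ≡ n → length (f G) ≡ n ∸ 3)
    × (∀ (P : List Step) → InK P → length P ≡ n ∸ 3 →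
    Σ (List Step) λ G → (SAB G × semiperimeter G ≡ n × f G ≡ P))))
mainTheorem20 =
  sabToK ,
  (λ G sab → let open FromSAB sab in InK-sabToK , #UD-sabToK , #H-sabToK) ,
  sabToK-injective ,
  (λ P inK → kToSab P , FromK.SAB-kToSab inK , FromK.sabToK-kToSab inK) ,
  λ n 3≤n →
    (λ G sab → FromSAB.length-sabToK sab) ,
    (λ P inK |P| → kToSab P , FromK.SAB-kToSab inK , FromK.semiperimeter-kToSab inK 3≤n |P| , FromK.sabToK-kToSab inK)
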